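{- Let $G=\mathrm{Aut}(\mathbb{Q},circ)$ and let $B_1,B_2$ be finite subsets of $\mathbb{Q}$. Then $G_{B_1\cap B_2}=\langle G_{B_1},G_{B_2}\rangle$.
   Context: $circ(x,y,z)$ iff $x<y<z$ or $y<z<x$ or $z<x<y$ on $\mathbb{Q}$; $\mathrm{Aut}(\mathbb{Q},circ)$ is the group of bijections of $\mathbb{Q}$ preserving $circ$. For finite $B$, $G_B$ is the pointwise stabilizer of $B$ in $G$; $\langle H_1,H_2\rangle$ is the subgroup generated by $H_1\cup H_2$. -}

module Defs where

open import Data.Rational using (ℚ; _<_)
open import Data.List using (List)
open import Data.List.Membership.Propositional using (_∈_)
open import Data.Product using (_×_; Σ; ∃)
open import Data.Sum using (_⊎_)
open import Function using (_∘_; id; _⇔_)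
open import Relation.Binary.PropositionalEquality using (_≡_)

circ : ℚ → ℚ → ℚ → Set
circ x y z = (x < y × y < z) ⊎ (y < z × z < x) ⊎ (z < x × x < y)

record Aut : Set where
  field
    to   : ℚ → ℚ
    from : ℚ → ℚ
    from∘to : ∀ x → from (to x) ≡ x
    to∘from : ∀ x → to (from x) ≡ x
    preserves : ∀ x y z → circ x y z ⇔ circ (to x) (to y) (to z)

open Aut public

Stab : (ℚ → Set) → Aut → Set
Stab S g = ∀ x → S x → to g x ≡ x

G_ : List ℚ → Aut → Set
G_ B = Stab (λ x → x ∈ B)

_∩_ : List ℚ → List ℚ → ℚ → Set
(B₁ ∩ B₂) x = x ∈ B₁ × x ∈ B₂

data Word (P : Aut → Set) : (ℚ → ℚ) → Set where
  []    : Word P id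
  _∷_   : ∀ {f} {h} → P h → Word P f → Word P (to h ∘ f)
  _⁻¹∷_ : ∀ {f} {h} → P h → Word P f → Word P (from h ∘ f)

⟨_,_⟩ : (Aut → Set) → (Aut → Set) → Aut → Set
⟨ H₁ , H₂ ⟩ g = Σ (ℚ → ℚ) λ f → Word (λ h → H₁ h ⊎ H₂ h) f × (∀ x → to g x ≡ f x)

-- Write A = B₁ ∩ B₂. It suffices to show G_A ⊆ ⟨G_{A ∪ {p}}, G_{B₂}⟩ for a point p ∈ B₁ ∖ B₂:
-- adding the points of B₁ ∖ B₂ to B₂ one at a time then gives G_A ⊆ ⟨G_{B₁}, G_{B₂}⟩, and the
-- other inclusion is clear. Piecewise affine order automorphisms of ℚ preserve circ, so inside
-- the gap of A containing p (a maximal interval of ℚ ∖ A) the group ⟨G_{A ∪ {p}}, G_{B₂}⟩ moves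
-- p to any point t: first slightly, fixing B₂, then on to t, fixing A ∪ {p}. Given g ∈ G_A,
-- take t with t and g t both in the gap of p: t = p works unless some a ∈ A separates p from
-- g p, and then t = g⁻¹ p works because g preserves the arcs into which A cuts the circle.
-- If K₁, K₂ move p to t and to g t, then K₂⁻¹ g K₁ fixes A ∪ {p}, so g ∈ ⟨G_{A ∪ {p}}, G_{B₂}⟩.

module Submission where

open import Defs
open import Data.Empty using (⊥-elim)
open import Data.List using (List; []; _∷_; _++_; filter)
open import Data.List.Membership.Propositional using (_∈_; _∉_; find)
open import Data.List.Relation.Unary.Any using (here; there)
open import Data.List.Relation.Binary.Subset.Propositional using (_⊆_)
open import Data.List.Relation.Binary.Subset.Propositional.Properties
  using (⊆-trans; ++⁺ʳ; xs⊆x∷xs; xs⊆xs++ys)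
open import Data.List.Membership.Propositional.Properties using (∈-++⁺ʳ; ∈-filter⁺; ∈-filter⁻)
open import Data.List.Relation.Unary.All as All using (all?)
open import Data.List.Relation.Unary.All.Properties using (¬All⇒Any¬)
open import Data.Product using (_×_; Σ; _,_; proj₁; proj₂)
open import Data.Rational
  using (ℚ; _<_; _≤_; _+_; _-_; -_; _*_; _÷_; 1/_; 1ℚ; _⊓_; _⊔_; Positive; NonZero; positive)
open import Data.Rational.Properties
  using ( <-cmp; <-trans; <-asym; <-irrefl; ≤-refl; ≤-trans; <⇒≤; ≤-<-trans; <-≤-trans
        ; ≮⇒≥; ≰⇒>; ≤-antisym; <-dense; _≤?_; _<?_; _≟_
        ; +-inverseʳ; +-identityʳ; +-monoˡ-<; +-monoʳ-<; *-monoˡ-<-pos; *-inverseʳ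
        ; pos⇒nonZero; 1/pos⇒pos; pos*pos⇒pos; negative⁻¹; positive⁻¹
        ; p⊓q≤p; p⊓q≤q; p≤p⊔q; p≤q⊔p )
open import Data.List.Membership.DecPropositional _≟_ using (_∈?_)
open import Data.Rational.Solver using (module +-*-Solver)
open +-*-Solver using (solve; _:=_; _:+_; _:*_; _:-_; con)
open import Data.Sum using (_⊎_; inj₁; inj₂; [_,_]; map; map₂)
open import Function using (_∘_; id; _⇔_; mk⇔; Equivalence)
open import Relation.Binary.Definitions using (tri<; tri≈; tri>)
open import Relation.Binary.PropositionalEquality
  using (_≡_; _≢_; _≗_; refl; sym; trans; cong; subst; subst₂; cong₂; module ≡-Reasoning)
open import Relation.Binary.Core using (_Preserves_⟶_)
open import Relation.Nullary using (¬_; Dec; yes; no)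
open import Relation.Nullary.Decidable using (_×-dec_; _⊎-dec_)

<⇒circ : ∀ {x y z} → x < y → y < z → circ x y z
<⇒circ x<y y<z = inj₁ (x<y , y<z)

circ-rotate : ∀ {x y z} → circ x y z → circ y z x
circ-rotate (inj₁ xyz)        = inj₂ (inj₂ xyz)
circ-rotate (inj₂ (inj₁ yzx)) = inj₁ yzx
circ-rotate (inj₂ (inj₂ zxy)) = inj₂ (inj₁ zxy)

circ-asym : ∀ {x y z} → circ x y z → ¬ circ x z y
circ-asym (inj₁ (_ , y<z))        (inj₁ (_ , z<y))        = <-asym y<z z<y
circ-asym (inj₁ (_ , y<z))        (inj₂ (inj₁ (z<y , _))) = <-asym y<z z<y
circ-asym (inj₁ (x<y , _))        (inj₂ (inj₂ (y<x , _))) = <-asym x<y y<x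
circ-asym (inj₂ (inj₁ (y<z , _))) (inj₁ (_ , z<y))        = <-asym y<z z<y
circ-asym (inj₂ (inj₁ (y<z , _))) (inj₂ (inj₁ (z<y , _))) = <-asym y<z z<y
circ-asym (inj₂ (inj₁ (_ , z<x))) (inj₂ (inj₂ (_ , x<z))) = <-asym z<x x<z
circ-asym (inj₂ (inj₂ (z<x , _))) (inj₁ (x<z , _))        = <-asym z<x x<z
circ-asym (inj₂ (inj₂ (_ , x<y))) (inj₂ (inj₁ (_ , y<x))) = <-asym x<y y<x
circ-asym (inj₂ (inj₂ (_ , x<y))) (inj₂ (inj₂ (y<x , _))) = <-asym x<y y<x

circ-map : ∀ {f} → f Preserves _<_ ⟶ _<_ → ∀ {x y z} → circ x y z → circ (f x) (f y) (f z)
circ-map mono (inj₁ (a , b))        = inj₁ (mono a , mono b)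
circ-map mono (inj₂ (inj₁ (a , b))) = inj₂ (inj₁ (mono a , mono b))
circ-map mono (inj₂ (inj₂ (a , b))) = inj₂ (inj₂ (mono a , mono b))

circ-resp-≡ : ∀ {x y z x′ y′ z′} → x ≡ x′ → y ≡ y′ → z ≡ z′ → circ x y z → circ x′ y′ z′
circ-resp-≡ refl refl refl c = c

idᴬ : Aut
idᴬ = record
  { to = id ; from = id ; from∘to = λ _ → refl ; to∘from = λ _ → refl
  ; preserves = λ _ _ _ → mk⇔ id id }

_∘ᴬ_ : Aut → Aut → Aut
h ∘ᴬ k = record
  { to        = to h ∘ to k
  ; from      = from k ∘ from h
  ; from∘to   = λ x → trans (cong (from k) (from∘to h (to k x))) (from∘to k x)
  ; to∘from   = λ x → trans (cong (to h) (to∘from k (from h x))) (to∘from h x)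
  ; preserves = λ x y z → mk⇔
      (Equivalence.to (preserves h _ _ _) ∘ Equivalence.to (preserves k x y z))
      (Equivalence.from (preserves k x y z) ∘ Equivalence.from (preserves h _ _ _)) }

_⁻¹ᴬ : Aut → Aut
h ⁻¹ᴬ = record
  { to = from h ; from = to h ; from∘to = to∘from h ; to∘from = from∘to h
  ; preserves = λ x y z → mk⇔
      (λ c → Equivalence.from (preserves h _ _ _) (circ-resp-≡ (sym (ε x)) (sym (ε y)) (sym (ε z)) c))
      (circ-resp-≡ (ε x) (ε y) (ε z) ∘ Equivalence.to (preserves h _ _ _)) }
  where ε = to∘from h

fixed⇒from-fixed : ∀ (h : Aut) {x} → to h x ≡ x → from h x ≡ x
fixed⇒from-fixed h {x} hx≡x = trans (cong (from h) (sym hx≡x)) (from∘to h x)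

Stab-⁻¹ : ∀ {S} h → Stab S h → Stab S (h ⁻¹ᴬ)
Stab-⁻¹ h h∈S x x∈S = fixed⇒from-fixed h (h∈S x x∈S)

Stab-antimono : ∀ {S T : ℚ → Set} → (∀ {x} → T x → S x) → ∀ h → Stab S h → Stab T h
Stab-antimono T⊆S h h∈S x x∈T = h∈S x (T⊆S x∈T)

-- Words in a set of automorphisms

Generated : (Aut → Set) → (ℚ → ℚ) → Set
Generated P φ = Σ (ℚ → ℚ) λ f → Word P f × φ ≗ f

module _ {P : Aut → Set} where

  generated-id : Generated P id
  generated-id = id , [] , λ _ → refl

  generated-to : ∀ h → P h → Generated P (to h)
  generated-to _ h∈P = _ , h∈P ∷ [] , λ _ → refl

  generated-from : ∀ h → P h → Generated P (from h)
  generated-from _ h∈P = _ , h∈P ⁻¹∷ [] , λ _ → refl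

  word-++ : ∀ {f g} → Word P f → Word P g → Word P (f ∘ g)
  word-++ []          w′ = w′
  word-++ (h ∷ w)     w′ = h ∷ word-++ w w′
  word-++ (h ⁻¹∷ w)   w′ = h ⁻¹∷ word-++ w w′

  generated-∘ : ∀ {φ ψ} → Generated P φ → Generated P ψ → Generated P (φ ∘ ψ)
  generated-∘ {ψ = ψ} (f , w , φ≗f) (g , w′ , ψ≗g) =
    f ∘ g , word-++ w w′ , λ x → trans (φ≗f (ψ x)) (cong f (ψ≗g x))

  generated-resp-≗ : ∀ {φ ψ} → ψ ≗ φ → Generated P φ → Generated P ψ
  generated-resp-≗ ψ≗φ (f , w , φ≗f) = f , w , λ x → trans (ψ≗φ x) (φ≗f x)

  word-fixes : ∀ {S f} → (∀ h → P h → Stab S h) → Word P f → ∀ x → S x → f x ≡ x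
  word-fixes P⊆S []                 x x∈S = refl
  word-fixes P⊆S (_∷_ {h = h} h∈P w) x x∈S =
    trans (cong (to h) (word-fixes P⊆S w x x∈S)) (P⊆S h h∈P x x∈S)
  word-fixes P⊆S (_⁻¹∷_ {h = h} h∈P w) x x∈S =
    trans (cong (from h) (word-fixes P⊆S w x x∈S)) (Stab-⁻¹ h (P⊆S h h∈P) x x∈S)

  generated-fixes : ∀ {S φ} → (∀ h → P h → Stab S h) → Generated P φ → ∀ x → S x → φ x ≡ x
  generated-fixes P⊆S (f , w , φ≗f) x x∈S = trans (φ≗f x) (word-fixes P⊆S w x x∈S)

generated-bind : ∀ {P Q : Aut → Set} {φ} →
                 (∀ h → P h → P (h ⁻¹ᴬ)) → (∀ h → P h → Generated Q (to h)) →
                 Generated P φ → Generated Q φ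
generated-bind {P} {Q} P-inv P⊆⟨Q⟩ (f , w , φ≗f) = generated-resp-≗ φ≗f (bind w)
  where
  bind : ∀ {f} → Word P f → Generated Q f
  bind []          = generated-id
  bind (_∷_ {h = h} h∈P w)   = generated-∘ (P⊆⟨Q⟩ h h∈P) (bind w)
  bind (_⁻¹∷_ {h = h} h∈P w) = generated-∘ (P⊆⟨Q⟩ (h ⁻¹ᴬ) (P-inv h h∈P)) (bind w)

generated-mono : ∀ {P Q : Aut → Set} {φ} → (∀ h → P h → Q h) → Generated P φ → Generated Q φ
generated-mono {P} {Q} P⊆Q (f , w , φ≗f) = f , map-word w , φ≗f
  where
  map-word : ∀ {f} → Word P f → Word Q f
  map-word []          = []
  map-word (_∷_ {h = h} h∈P w)   = P⊆Q h h∈P ∷ map-word w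
  map-word (_⁻¹∷_ {h = h} h∈P w) = P⊆Q h h∈P ⁻¹∷ map-word w

-- Order automorphisms of ℚ

module StrictlyMonotone {f : ℚ → ℚ} (f-mono : f Preserves _<_ ⟶ _<_) where

  cancel-< : ∀ {x y} → f x < f y → x < y
  cancel-< {x} {y} fx<fy with <-cmp x y
  ... | tri< x<y _ _ = x<y
  ... | tri≈ _ refl _ = ⊥-elim (<-irrefl refl fx<fy)
  ... | tri> _ _ y<x = ⊥-elim (<-asym fx<fy (f-mono y<x))

  mono-≤ : f Preserves _≤_ ⟶ _≤_
  mono-≤ x≤y = ≮⇒≥ λ fy<fx → <-irrefl refl (≤-<-trans x≤y (cancel-< fy<fx))

record OrderAut : Set where
  field
    f      : ℚ → ℚ
    f⁻¹    : ℚ → ℚ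
    f⁻¹∘f  : ∀ x → f⁻¹ (f x) ≡ x
    f∘f⁻¹  : ∀ y → f (f⁻¹ y) ≡ y
    f-mono : f Preserves _<_ ⟶ _<_

  open StrictlyMonotone f-mono public using (mono-≤)

  f⁻¹-mono : f⁻¹ Preserves _<_ ⟶ _<_
  f⁻¹-mono {x} {y} x<y =
    StrictlyMonotone.cancel-< f-mono (subst₂ _<_ (sym (f∘f⁻¹ x)) (sym (f∘f⁻¹ y)) x<y)

  f⁻¹-mono-≤ : f⁻¹ Preserves _≤_ ⟶ _≤_
  f⁻¹-mono-≤ = StrictlyMonotone.mono-≤ f⁻¹-mono

  aut : Aut
  aut = record
    { to = f ; from = f⁻¹ ; from∘to = f⁻¹∘f ; to∘from = f∘f⁻¹
    ; preserves = λ x y z → mk⇔ (circ-map f-mono)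
        (circ-resp-≡ (f⁻¹∘f x) (f⁻¹∘f y) (f⁻¹∘f z) ∘ circ-map f⁻¹-mono) }

idᴼ : OrderAut
idᴼ = record { f = id ; f⁻¹ = id ; f⁻¹∘f = λ _ → refl ; f∘f⁻¹ = λ _ → refl ; f-mono = id }

module Glue (A B : OrderAut) (c : ℚ) (Ac≡Bc : OrderAut.f A c ≡ OrderAut.f B c) where
  private
    module A = OrderAut A
    module B = OrderAut B

  glue-f : ℚ → ℚ
  glue-f x with x ≤? c
  ... | yes _ = A.f x
  ... | no _  = B.f x

  glue-f⁻¹ : ℚ → ℚ
  glue-f⁻¹ y with y ≤? A.f c
  ... | yes _ = A.f⁻¹ y
  ... | no _  = B.f⁻¹ y

  glue-≤ : ∀ {x} → x ≤ c → glue-f x ≡ A.f x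
  glue-≤ {x} x≤c with x ≤? c
  ... | yes _   = refl
  ... | no x≰c = ⊥-elim (x≰c x≤c)

  glue-≥ : ∀ {x} → c ≤ x → glue-f x ≡ B.f x
  glue-≥ {x} c≤x with x ≤? c
  ... | yes x≤c = subst (λ y → A.f y ≡ B.f y) (sym (≤-antisym x≤c c≤x)) Ac≡Bc
  ... | no _    = refl

  private
    Bc<Bx : ∀ {x} → ¬ x ≤ c → A.f c < B.f x
    Bc<Bx x≰c = subst (_< _) (sym Ac≡Bc) (B.f-mono (≰⇒> x≰c))

  glue-f⁻¹∘f : ∀ x → glue-f⁻¹ (glue-f x) ≡ x
  glue-f⁻¹∘f x with x ≤? c
  ... | yes x≤c with A.f x ≤? A.f c
  ...   | yes _ = A.f⁻¹∘f x
  ...   | no Ax≰Ac = ⊥-elim (Ax≰Ac (A.mono-≤ x≤c))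
  glue-f⁻¹∘f x | no x≰c with B.f x ≤? A.f c
  ...   | yes Bx≤Ac = ⊥-elim (<-irrefl refl (<-≤-trans (Bc<Bx x≰c) Bx≤Ac))
  ...   | no _ = B.f⁻¹∘f x

  glue-f∘f⁻¹ : ∀ y → glue-f (glue-f⁻¹ y) ≡ y
  glue-f∘f⁻¹ y with y ≤? A.f c
  ... | yes y≤Ac = trans (glue-≤ (subst (_ ≤_) (A.f⁻¹∘f c) (A.f⁻¹-mono-≤ y≤Ac))) (A.f∘f⁻¹ y)
  ... | no y≰Ac  = trans (glue-≥ (<⇒≤ c<B⁻¹y)) (B.f∘f⁻¹ y)
    where
    c<B⁻¹y : c < B.f⁻¹ y
    c<B⁻¹y = subst (_< _) (B.f⁻¹∘f c) (B.f⁻¹-mono (subst (_< y) Ac≡Bc (≰⇒> y≰Ac)))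

  glue-mono : glue-f Preserves _<_ ⟶ _<_
  glue-mono {x} {y} x<y with x ≤? c | y ≤? c
  ... | yes _   | yes _   = A.f-mono x<y
  ... | yes x≤c | no y≰c  = ≤-<-trans (A.mono-≤ x≤c) (Bc<Bx y≰c)
  ... | no x≰c  | yes y≤c = ⊥-elim (<-irrefl refl (<-trans (≰⇒> x≰c) (<-≤-trans x<y y≤c)))
  ... | no _    | no _    = B.f-mono x<y

  glue : OrderAut
  glue = record
    { f = glue-f ; f⁻¹ = glue-f⁻¹ ; f⁻¹∘f = glue-f⁻¹∘f ; f∘f⁻¹ = glue-f∘f⁻¹ ; f-mono = glue-mono }

<⇒positive-difference : ∀ {p q} → p < q → Positive (q - p)
<⇒positive-difference {p} {q} p<q =
  positive (subst (_< q - p) (+-inverseʳ p) (+-monoˡ-< (- p) p<q))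

line : (p₁ p₂ q₁ q₂ : ℚ) .{{_ : NonZero (p₂ - p₁)}} → ℚ → ℚ
line p₁ p₂ q₁ q₂ x = q₁ + (x - p₁) * ((q₂ - q₁) ÷ (p₂ - p₁))

module _ (p₁ p₂ q₁ q₂ : ℚ) .{{_ : NonZero (p₂ - p₁)}} where

  line-start : line p₁ p₂ q₁ q₂ p₁ ≡ q₁
  line-start = solve 3 (λ p₁ q₁ s → q₁ :+ (p₁ :- p₁) :* s := q₁) refl p₁ q₁ ((q₂ - q₁) ÷ (p₂ - p₁))

  line-end : line p₁ p₂ q₁ q₂ p₂ ≡ q₂
  line-end = begin
    q₁ + (p₂ - p₁) * ((q₂ - q₁) * 1/ (p₂ - p₁))
      ≡⟨ solve 4 (λ q₁ d e i → q₁ :+ d :* (e :* i) := q₁ :+ e :* (d :* i))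
               refl q₁ (p₂ - p₁) (q₂ - q₁) (1/ (p₂ - p₁)) ⟩
    q₁ + (q₂ - q₁) * ((p₂ - p₁) * 1/ (p₂ - p₁))
      ≡⟨ cong (λ z → q₁ + (q₂ - q₁) * z) (*-inverseʳ (p₂ - p₁)) ⟩
    q₁ + (q₂ - q₁) * 1ℚ
      ≡⟨ solve 2 (λ q₁ q₂ → q₁ :+ (q₂ :- q₁) :* con 1ℚ := q₂) refl q₁ q₂ ⟩
    q₂ ∎
    where open ≡-Reasoning

  line-inverse : .{{_ : NonZero (q₂ - q₁)}} → ∀ x → line q₁ q₂ p₁ p₂ (line p₁ p₂ q₁ q₂ x) ≡ x
  line-inverse x = begin
    p₁ + ((q₁ + (x - p₁) * (e * 1/ d)) - q₁) * (d * 1/ e)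
      ≡⟨ solve 7 (λ p₁ q₁ x d e i j → p₁ :+ ((q₁ :+ (x :- p₁) :* (e :* i)) :- q₁) :* (d :* j)
                   := p₁ :+ (x :- p₁) :* ((e :* j) :* (d :* i))) refl p₁ q₁ x d e (1/ d) (1/ e) ⟩
    p₁ + (x - p₁) * ((e * 1/ e) * (d * 1/ d))
      ≡⟨ cong₂ (λ u v → p₁ + (x - p₁) * (u * v)) (*-inverseʳ e) (*-inverseʳ d) ⟩
    p₁ + (x - p₁) * (1ℚ * 1ℚ)
      ≡⟨ solve 2 (λ p₁ x → p₁ :+ (x :- p₁) :* (con 1ℚ :* con 1ℚ) := x) refl p₁ x ⟩
    x ∎
    where
    open ≡-Reasoning
    d = p₂ - p₁
    e = q₂ - q₁

  line-mono : .{{_ : Positive ((q₂ - q₁) ÷ (p₂ - p₁))}} → line p₁ p₂ q₁ q₂ Preserves _<_ ⟶ _<_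
  line-mono x<y = +-monoʳ-< q₁ (*-monoˡ-<-pos ((q₂ - q₁) ÷ (p₂ - p₁)) (+-monoˡ-< (- p₁) x<y))

module _ {p₁ p₂ q₁ q₂ : ℚ} (p₁<p₂ : p₁ < p₂) (q₁<q₂ : q₁ < q₂) where
  private instance
    Δp>0 : Positive (p₂ - p₁)
    Δp>0 = <⇒positive-difference p₁<p₂
    Δq>0 : Positive (q₂ - q₁)
    Δq>0 = <⇒positive-difference q₁<q₂
    Δp≢0 : NonZero (p₂ - p₁)
    Δp≢0 = pos⇒nonZero (p₂ - p₁)
    Δq≢0 : NonZero (q₂ - q₁)
    Δq≢0 = pos⇒nonZero (q₂ - q₁)
    1/Δp>0 : Positive (1/ (p₂ - p₁))
    1/Δp>0 = 1/pos⇒pos (p₂ - p₁)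
    slope>0 : Positive ((q₂ - q₁) ÷ (p₂ - p₁))
    slope>0 = pos*pos⇒pos (q₂ - q₁) (1/ (p₂ - p₁))

  affine : OrderAut
  affine = record
    { f = line p₁ p₂ q₁ q₂ ; f⁻¹ = line q₁ q₂ p₁ p₂
    ; f⁻¹∘f = line-inverse p₁ p₂ q₁ q₂ ; f∘f⁻¹ = line-inverse q₁ q₂ p₁ p₂
    ; f-mono = line-mono p₁ p₂ q₁ q₂ }

  affine-start : OrderAut.f affine p₁ ≡ q₁
  affine-start = line-start p₁ p₂ q₁ q₂

  affine-end : OrderAut.f affine p₂ ≡ q₂
  affine-end = line-end p₁ p₂ q₁ q₂

module Bump {l u v r : ℚ} (l<u : l < u) (l<v : l < v) (u<r : u < r) (v<r : v < r) where
  private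
    module L = Glue idᴼ (affine l<u l<v) l (sym (affine-start l<u l<v))
    module R = Glue (affine u<r v<r) idᴼ r (affine-end u<r v<r)

    Lu≡Ru : L.glue-f u ≡ R.glue-f u
    Lu≡Ru = begin
      L.glue-f u                         ≡⟨ L.glue-≥ (<⇒≤ l<u) ⟩
      OrderAut.f (affine l<u l<v) u      ≡⟨ affine-end l<u l<v ⟩
      v                                  ≡⟨ affine-start u<r v<r ⟨
      OrderAut.f (affine u<r v<r) u      ≡⟨ R.glue-≤ (<⇒≤ u<r) ⟨
      R.glue-f u                         ∎
      where open ≡-Reasoning

    module M = Glue L.glue R.glue u Lu≡Ru

  bump : OrderAut
  bump = M.glue

  bump-moves : OrderAut.f bump u ≡ v
  bump-moves = trans (M.glue-≤ ≤-refl) (trans (L.glue-≥ (<⇒≤ l<u)) (affine-end l<u l<v))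

  bump-fixes-≤ : ∀ {x} → x ≤ l → OrderAut.f bump x ≡ x
  bump-fixes-≤ x≤l = trans (M.glue-≤ (≤-trans x≤l (<⇒≤ l<u))) (L.glue-≤ x≤l)

  bump-fixes-≥ : ∀ {x} → r ≤ x → OrderAut.f bump x ≡ x
  bump-fixes-≥ r≤x = trans (M.glue-≥ (<⇒≤ (<-≤-trans u<r r≤x))) (R.glue-≥ r≤x)

-- Moving one point while fixing finitely many others

p-1<p : ∀ p → p - 1ℚ < p
p-1<p p = subst (p - 1ℚ <_) (+-identityʳ p) (+-monoʳ-< p (negative⁻¹ (- 1ℚ)))

p<p+1 : ∀ p → p < p + 1ℚ
p<p+1 p = subst (_< p + 1ℚ) (+-identityʳ p) (+-monoʳ-< p (positive⁻¹ 1ℚ))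

boundBelow : (L : List ℚ) (u v : ℚ) →
             Σ ℚ λ l → l < u × l < v × (∀ {x} → x ∈ L → x < u → x < v → x ≤ l)
boundBelow [] u v =
  (u ⊓ v) - 1ℚ , <-≤-trans (p-1<p _) (p⊓q≤p u v) , <-≤-trans (p-1<p _) (p⊓q≤q u v) , λ ()
boundBelow (y ∷ L) u v with boundBelow L u v
... | l , l<u , l<v , below with y <? u ×-dec y <? v | y ≤? l
...   | yes (y<u , y<v) | no y≰l =
  y , y<u , y<v , λ { (here refl) _ _ → ≤-refl
                    ; (there x∈L) x<u x<v → ≤-trans (below x∈L x<u x<v) (<⇒≤ (≰⇒> y≰l)) }
...   | _ | yes y≤l = l , l<u , l<v , λ { (here refl) _ _ → y≤l ; (there x∈L) → below x∈L }
...   | no ¬y<u,v | _ =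
  l , l<u , l<v , λ { (here refl) y<u y<v → ⊥-elim (¬y<u,v (y<u , y<v)) ; (there x∈L) → below x∈L }

boundAbove : (L : List ℚ) (u v : ℚ) →
             Σ ℚ λ r → u < r × v < r × (∀ {x} → x ∈ L → u < x → v < x → r ≤ x)
boundAbove [] u v =
  (u ⊔ v) + 1ℚ , ≤-<-trans (p≤p⊔q u v) (p<p+1 _) , ≤-<-trans (p≤q⊔p u v) (p<p+1 _) , λ ()
boundAbove (y ∷ L) u v with boundAbove L u v
... | r , u<r , v<r , above with u <? y ×-dec v <? y | r ≤? y
...   | yes (u<y , v<y) | no r≰y =
  y , u<y , v<y , λ { (here refl) _ _ → ≤-refl
                    ; (there x∈L) u<x v<x → ≤-trans (<⇒≤ (≰⇒> r≰y)) (above x∈L u<x v<x) }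
...   | _ | yes r≤y = r , u<r , v<r , λ { (here refl) _ _ → r≤y ; (there x∈L) → above x∈L }
...   | no ¬u,v<y | _ =
  r , u<r , v<r , λ { (here refl) u<y v<y → ⊥-elim (¬u,v<y (u<y , v<y)) ; (there x∈L) → above x∈L }

SameSide : ℚ → ℚ → ℚ → Set
SameSide u v x = (x < u × x < v) ⊎ (u < x × v < x)

opaque
  moveFixing : (L : List ℚ) (u v : ℚ) → (∀ {x} → x ∈ L → SameSide u v x) →
               Σ Aut λ h → to h u ≡ v × G_ L h
  moveFixing L u v L-beside with boundBelow L u v | boundAbove L u v
  ... | l , l<u , l<v , below | r , u<r , v<r , above =
    OrderAut.aut bump , bump-moves , λ x x∈L → fixes x∈L (L-beside x∈L)
    where
    open Bump l<u l<v u<r v<r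

    fixes : ∀ {x} → x ∈ L → SameSide u v x → OrderAut.f bump x ≡ x
    fixes x∈L (inj₁ (x<u , x<v)) = bump-fixes-≤ (below x∈L x<u x<v)
    fixes x∈L (inj₂ (u<x , v<x)) = bump-fixes-≥ (above x∈L u<x v<x)

≢⇒<⊎> : ∀ {x y} → x ≢ y → x < y ⊎ y < x
≢⇒<⊎> {x} {y} x≢y with <-cmp x y
... | tri< x<y _ _ = inj₁ x<y
... | tri≈ _ x≡y _ = ⊥-elim (x≢y x≡y)
... | tri> _ _ y<x = inj₂ y<x

≢∧≯⇒< : ∀ {x y} → x ≢ y → ¬ y < x → x < y
≢∧≯⇒< x≢y y≮x = [ id , ⊥-elim ∘ y≮x ] (≢⇒<⊎> x≢y)

≢⇒sameSide-self : ∀ {u x} → x ≢ u → SameSide u u x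
≢⇒sameSide-self = map (λ x<u → x<u , x<u) (λ u<x → u<x , u<x) ∘ ≢⇒<⊎>

Between : ℚ → ℚ → ℚ → Set
Between u x v = (u < x × x < v) ⊎ (v < x × x < u)

sameSide? : ∀ u v x → Dec (SameSide u v x)
sameSide? u v x = (x <? u ×-dec x <? v) ⊎-dec (u <? x ×-dec v <? x)

¬sameSide⇒between : ∀ {u v x} → x ≢ u → x ≢ v → ¬ SameSide u v x → Between u x v
¬sameSide⇒between {u} {v} {x} x≢u x≢v x≁ with <-cmp x u | <-cmp x v
... | tri< x<u _ _ | tri< x<v _ _ = ⊥-elim (x≁ (inj₁ (x<u , x<v)))
... | tri< x<u _ _ | tri> _ _ v<x = inj₂ (v<x , x<u)
... | tri> _ _ u<x | tri< x<v _ _ = inj₁ (u<x , x<v)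
... | tri> _ _ u<x | tri> _ _ v<x = ⊥-elim (x≁ (inj₂ (u<x , v<x)))
... | tri≈ _ x≡u _ | _ = ⊥-elim (x≢u x≡u)
... | _ | tri≈ _ x≡v _ = ⊥-elim (x≢v x≡v)

between⇒sameSide : ∀ {u q v} → Between u q v → SameSide q v u
between⇒sameSide (inj₁ (u<q , q<v)) = inj₁ (u<q , <-trans u<q q<v)
between⇒sameSide (inj₂ (v<q , q<u)) = inj₂ (q<u , <-trans v<q q<u)

sameSide-between : ∀ {u q v x} → Between u q v → SameSide u v x → SameSide q v x
sameSide-between (inj₁ (u<q , _)) (inj₁ (x<u , x<v)) = inj₁ (<-trans x<u u<q , x<v)
sameSide-between (inj₁ (_ , q<v)) (inj₂ (_ , v<x))   = inj₂ (<-trans q<v v<x , v<x)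
sameSide-between (inj₂ (v<q , _)) (inj₁ (_ , x<v))   = inj₁ (<-trans x<v v<q , x<v)
sameSide-between (inj₂ (_ , q<u)) (inj₂ (u<x , v<x)) = inj₂ (<-trans q<u u<x , v<x)

towards : (L : List ℚ) {u v : ℚ} → u ≢ v →
          Σ ℚ λ q → Between u q v × (∀ {x} → x ∈ L → x ≢ u → SameSide u q x)
towards L {u} {v} u≢v with ≢⇒<⊎> u≢v
... | inj₁ u<v with boundAbove (v ∷ L) u u
...   | r , u<r , _ , above with <-dense u<r
...     | q , u<q , q<r = q , inj₁ (u<q , <-≤-trans q<r (above (here refl) u<v u<v)) , beside
  where
  beside : ∀ {x} → x ∈ L → x ≢ u → SameSide u q x
  beside x∈L x≢u with ≢⇒<⊎> x≢u
  ... | inj₁ x<u = inj₁ (x<u , <-trans x<u u<q)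
  ... | inj₂ u<x = inj₂ (u<x , <-≤-trans q<r (above (there x∈L) u<x u<x))
towards L {u} {v} u≢v | inj₂ v<u with boundBelow (v ∷ L) u u
...   | l , l<u , _ , below with <-dense l<u
...     | q , l<q , q<u = q , inj₂ (≤-<-trans (below (here refl) v<u v<u) l<q , q<u) , beside
  where
  beside : ∀ {x} → x ∈ L → x ≢ u → SameSide u q x
  beside x∈L x≢u with ≢⇒<⊎> x≢u
  ... | inj₁ x<u = inj₁ (x<u , ≤-<-trans (below (there x∈L) x<u x<u) l<q)
  ... | inj₂ u<x = inj₂ (u<x , <-trans q<u u<x)

-- Adding one fixed point to the intersection

module OnePointStep (A B : List ℚ) (A⊆B : A ⊆ B) {p : ℚ} (p∉B : p ∉ B) where

  Gens : Aut → Set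
  Gens h = G_ (p ∷ A) h ⊎ G_ B h

  gens-fix-A : ∀ h → Gens h → G_ A h
  gens-fix-A _ (inj₁ h∈G) x x∈A = h∈G x (there x∈A)
  gens-fix-A _ (inj₂ h∈G) x x∈A = h∈G x (A⊆B x∈A)

  B∌p : ∀ {x} → x ∈ B → x ≢ p
  B∌p x∈B refl = p∉B x∈B

  A∌p : ∀ {a} → a ∈ A → a ≢ p
  A∌p = B∌p ∘ A⊆B

  Reachable : ℚ → Set
  Reachable t = ∀ {a} → a ∈ A → SameSide p t a

  reachable-self : Reachable p
  reachable-self = ≢⇒sameSide-self ∘ A∌p

  ⟨Gens⟩-path : ℚ → Set
  ⟨Gens⟩-path t = Σ Aut λ K → Generated Gens (to K) × Generated Gens (from K) × to K p ≡ t

  path-via : ∀ {q t} → (∀ {x} → x ∈ B → SameSide p q x) →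
             (∀ {x} → x ∈ p ∷ A → SameSide q t x) → ⟨Gens⟩-path t
  path-via {q} {t} B~q p∷A~t with moveFixing B p q B~q | moveFixing (p ∷ A) q t p∷A~t
  ... | k₁ , k₁p≡q , k₁∈G | k₂ , k₂q≡t , k₂∈G =
    k₂ ∘ᴬ k₁ ,
    generated-∘ (generated-to k₂ (inj₁ k₂∈G)) (generated-to k₁ (inj₂ k₁∈G)) ,
    generated-∘ (generated-from k₁ (inj₂ k₁∈G)) (generated-from k₂ (inj₁ k₂∈G)) ,
    trans (cong (to k₂) k₁p≡q) k₂q≡t

  reach : ∀ {t} → Reachable t → ⟨Gens⟩-path t
  reach {t} t~p with p ≟ t
  ... | yes refl = idᴬ , generated-id , generated-id , refl
  ... | no p≢t with towards B p≢t
  ...   | q , p-q-t , q~p = path-via (λ x∈B → q~p x∈B (B∌p x∈B)) p∷A~t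
    where
    p∷A~t : ∀ {x} → x ∈ p ∷ A → SameSide q t x
    p∷A~t (here refl)  = between⇒sameSide p-q-t
    p∷A~t (there a∈A) = sameSide-between p-q-t (t~p a∈A)

  module _ (g : Aut) (g∈G : G_ A g) where

    generated-if-reachable : ∀ {t} → Reachable t → Reachable (to g t) → Generated Gens (to g)
    generated-if-reachable {t} t~p gt~p with reach t~p | reach gt~p
    ... | K₁ , _ , K₁⁻¹∈⟨G⟩ , K₁p≡t | K₂ , K₂∈⟨G⟩ , _ , K₂p≡gt =
      generated-resp-≗ g≗K₂g′K₁⁻¹
        (generated-∘ K₂∈⟨G⟩ (generated-∘ (generated-to g′ (inj₁ g′∈G)) K₁⁻¹∈⟨G⟩))
      where
      g′ : Aut
      g′ = (K₂ ⁻¹ᴬ) ∘ᴬ (g ∘ᴬ K₁)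

      K₁-fixes-A : G_ A K₁
      K₁-fixes-A x x∈A =
        fixed⇒from-fixed (K₁ ⁻¹ᴬ) (generated-fixes gens-fix-A K₁⁻¹∈⟨G⟩ x x∈A)

      g′∈G : G_ (p ∷ A) g′
      g′∈G x (here refl) = begin
        from K₂ (to g (to K₁ p))  ≡⟨ cong (from K₂ ∘ to g) K₁p≡t ⟩
        from K₂ (to g t)          ≡⟨ cong (from K₂) K₂p≡gt ⟨
        from K₂ (to K₂ p)         ≡⟨ from∘to K₂ p ⟩
        p                         ∎
        where open ≡-Reasoning
      g′∈G x (there x∈A) = begin
        from K₂ (to g (to K₁ x))  ≡⟨ cong (from K₂ ∘ to g) (K₁-fixes-A x x∈A) ⟩
        from K₂ (to g x)          ≡⟨ cong (from K₂) (g∈G x x∈A) ⟩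
        from K₂ x                 ≡⟨ fixed⇒from-fixed K₂ K₂x≡x ⟩
        x                         ∎
        where
        open ≡-Reasoning
        K₂x≡x = generated-fixes gens-fix-A K₂∈⟨G⟩ x x∈A

      g≗K₂g′K₁⁻¹ : to g ≗ to K₂ ∘ to g′ ∘ from K₁
      g≗K₂g′K₁⁻¹ x = sym (trans (to∘from K₂ _) (cong (to g) (to∘from K₁ x)))

    private
      fixes : ∀ {a} → a ∈ A → to g a ≡ a
      fixes a∈A = g∈G _ a∈A

      transport : ∀ {x y z} → circ x y z → circ (to g x) (to g y) (to g z)
      transport = Equivalence.to (preserves g _ _ _)

      pullback : ∀ {x y z} → circ (to g x) (to g y) (to g z) → circ x y z
      pullback = Equivalence.from (preserves g _ _ _)

      gp≢a : ∀ {a} → a ∈ A → to g p ≢ a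
      gp≢a a∈A gp≡a = A∌p a∈A (trans (sym (fixed⇒from-fixed g (fixes a∈A)))
                                      (trans (cong (from g) (sym gp≡a)) (from∘to g p)))

      g⁻¹p≢a : ∀ {a} → a ∈ A → from g p ≢ a
      g⁻¹p≢a a∈A g⁻¹p≡a = A∌p a∈A (trans (sym (fixes a∈A))
                                        (trans (cong (to g) (sym g⁻¹p≡a)) (to∘from g p)))

    -- Here p and g p lie on the arc of A through ±∞, which g maps onto itself preserving its order.
    reachable-preimage : ∀ {a} → a ∈ A → Between p a (to g p) → Reachable (from g p)
    reachable-preimage {a} a∈A (inj₁ (p<a , a<gp)) {a′} a′∈A = inj₂ (p<a′ , g⁻¹p<a′)
      where
      p<a′ : p < a′
      p<a′ = ≢∧≯⇒< (A∌p a′∈A ∘ sym) λ a′<p →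
        circ-asym (<⇒circ (<-trans a′<p p<a) a<gp)
          (circ-resp-≡ (fixes a′∈A) refl (fixes a∈A) (transport (<⇒circ a′<p p<a)))
      a′<gp : a′ < to g p
      a′<gp = ≢∧≯⇒< (gp≢a a′∈A ∘ sym) λ gp<a′ →
        circ-asym (circ-rotate (<⇒circ p<a (<-trans a<gp gp<a′)))
          (pullback (circ-resp-≡ (sym (fixes a∈A)) refl (sym (fixes a′∈A)) (<⇒circ a<gp gp<a′)))
      g⁻¹p<a′ : from g p < a′
      g⁻¹p<a′ = ≢∧≯⇒< (g⁻¹p≢a a′∈A) λ a′<g⁻¹p →
        circ-asym (circ-rotate (circ-rotate (<⇒circ p<a′ a′<gp)))
          (circ-resp-≡ refl (fixes a′∈A) (to∘from g p) (transport (<⇒circ p<a′ a′<g⁻¹p)))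
    reachable-preimage {a} a∈A (inj₂ (gp<a , a<p)) {a′} a′∈A = inj₁ (a′<p , a′<g⁻¹p)
      where
      a′<p : a′ < p
      a′<p = ≢∧≯⇒< (A∌p a′∈A) λ p<a′ →
        circ-asym (circ-rotate (<⇒circ gp<a (<-trans a<p p<a′)))
          (circ-resp-≡ (fixes a∈A) refl (fixes a′∈A) (transport (<⇒circ a<p p<a′)))
      gp<a′ : to g p < a′
      gp<a′ = ≢∧≯⇒< (gp≢a a′∈A) λ a′<gp →
        circ-asym (<⇒circ (<-trans a′<gp gp<a) a<p)
          (pullback (circ-resp-≡ (sym (fixes a′∈A)) refl (sym (fixes a∈A)) (<⇒circ a′<gp gp<a)))
      a′<g⁻¹p : a′ < from g p
      a′<g⁻¹p = ≢∧≯⇒< (g⁻¹p≢a a′∈A ∘ sym) λ g⁻¹p<a′ →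
        circ-asym (circ-rotate (circ-rotate (<⇒circ gp<a′ a′<p)))
          (circ-resp-≡ (to∘from g p) (fixes a′∈A) refl (transport (<⇒circ g⁻¹p<a′ a′<p)))

    reachable-pair : Σ ℚ λ t → Reachable t × Reachable (to g t)
    reachable-pair with all? (sameSide? p (to g p)) A
    ... | yes gp~p = p , reachable-self , All.lookup gp~p
    ... | no ¬gp~p with find (¬All⇒Any¬ (sameSide? p (to g p)) A ¬gp~p)
    ...   | a , a∈A , a≁ =
      from g p ,
      reachable-preimage a∈A (¬sameSide⇒between (A∌p a∈A) (gp≢a a∈A ∘ sym) a≁) ,
      subst Reachable (sym (to∘from g p)) reachable-self

    stabiliser-step : Generated Gens (to g)
    stabiliser-step with reachable-pair
    ... | t , t~p , gt~p = generated-if-reachable t~p gt~p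

Stab-∪-⁻¹ : ∀ {S T : ℚ → Set} h → Stab S h ⊎ Stab T h → Stab S (h ⁻¹ᴬ) ⊎ Stab T (h ⁻¹ᴬ)
Stab-∪-⁻¹ h (inj₁ h∈S) = inj₁ (Stab-⁻¹ h h∈S)
Stab-∪-⁻¹ h (inj₂ h∈T) = inj₂ (Stab-⁻¹ h h∈T)

-- L lists the points of B₁ still missing from B₂; they are added to B₂ one at a time.
stabiliser-generated : (B₁ L B₂ : List ℚ) → B₁ ⊆ L ++ B₂ → ∀ g → Stab (B₁ ∩ B₂) g →
                       Generated (λ h → G_ B₁ h ⊎ G_ B₂ h) (to g)
stabiliser-generated B₁ []      B₂ B₁⊆B₂ g g∈G =
  generated-to g (inj₁ λ x x∈B₁ → g∈G x (x∈B₁ , B₁⊆B₂ x∈B₁))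
stabiliser-generated B₁ (p ∷ L) B₂ B₁⊆p∷L++B₂ g g∈G with p ∈? B₂
... | yes p∈B₂ = stabiliser-generated B₁ L B₂ (⊆-trans B₁⊆p∷L++B₂ drop-p) g g∈G
  where
  drop-p : p ∷ (L ++ B₂) ⊆ L ++ B₂
  drop-p (here refl)   = ∈-++⁺ʳ L p∈B₂
  drop-p (there x∈L++B₂) = x∈L++B₂
... | no p∉B₂ =
  generated-bind Stab-∪-⁻¹ step-generators
    (OnePointStep.stabiliser-step A B₂ (proj₂ ∘ A⊆B₁∩B₂) p∉B₂ g (Stab-antimono A⊆B₁∩B₂ g g∈G))
  where
  A : List ℚ
  A = filter (_∈? B₂) B₁

  A⊆B₁∩B₂ : ∀ {x} → x ∈ A → (B₁ ∩ B₂) x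
  A⊆B₁∩B₂ = ∈-filter⁻ (_∈? B₂) {xs = B₁}

  move-p : p ∷ (L ++ B₂) ⊆ L ++ (p ∷ B₂)
  move-p (here refl)   = ∈-++⁺ʳ L (here refl)
  move-p (there x∈L++B₂) = ++⁺ʳ L (xs⊆x∷xs B₂ p) x∈L++B₂

  B₁∩p∷B₂⊆p∷A : ∀ {x} → (B₁ ∩ (p ∷ B₂)) x → x ∈ p ∷ A
  B₁∩p∷B₂⊆p∷A (_ , here refl)        = here refl
  B₁∩p∷B₂⊆p∷A (x∈B₁ , there x∈B₂) = there (∈-filter⁺ (_∈? B₂) x∈B₁ x∈B₂)

  step-generators : ∀ h → G_ (p ∷ A) h ⊎ G_ B₂ h → Generated (λ h → G_ B₁ h ⊎ G_ B₂ h) (to h)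
  step-generators h (inj₁ h∈G) =
    generated-mono (λ h → map₂ (Stab-antimono there h))
      (stabiliser-generated B₁ L (p ∷ B₂) (⊆-trans B₁⊆p∷L++B₂ move-p) h
        (Stab-antimono B₁∩p∷B₂⊆p∷A h h∈G))
  step-generators h (inj₂ h∈G) = generated-to h (inj₂ h∈G)

lemma3p8 : (B₁ B₂ : List ℚ) (g : Aut) →
    Stab (B₁ ∩ B₂) g ⇔ ⟨ G_ B₁ , G_ B₂ ⟩ g
lemma3p8 B₁ B₂ g = mk⇔
  (stabiliser-generated B₁ B₁ B₂ (xs⊆xs++ys B₁ B₂) g)
  (generated-fixes λ h → [ Stab-antimono proj₁ h , Stab-antimono proj₂ h ])
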